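{- Define, for $n\in\mathbb N$, $$g(n) := 2 + \min\Big( \big(2\cdot n!\big) \bmod (n+1),\ \big(2\cdot (2n+2)!\big) \bmod (2n+3)\Big).$$ Then: (i) For every $n\in\mathbb N$, $g(n)$ is a Sophie Germain prime. (ii) Every Sophie Germain prime equals $g(n)$ for some $n\in\mathbb N$.
   Context: $\mathbb N=\{0,1,2,\dots\}$. For natural numbers $a$ and $b\ge1$, $a \bmod b$ denotes the remainder of $a$ upon division by $b$; in particular $a\bmod 1=0$. A Sophie Germain prime is a prime $p$ such that $2p+1$ is also prime. -}

module Defs where

open import Data.Nat using (ℕ; suc; _+_; _*_; _⊓_; _!)
open import Data.Nat.DivMod using (_%_)
open import Data.Nat.Primality using (Prime)
open import Data.Product using (_×_)

SophieGermain : ℕ → Set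
SophieGermain p = Prime p × Prime (2 * p + 1)

g : ℕ → ℕ
g n = 2 + (((2 * (n !)) % suc n) ⊓ ((2 * ((2 * n + 2) !)) % suc (2 * n + 2)))

-- If p = n + 1 is prime, Wilson's theorem gives 2 · n! ≡ -2, so (2 · n!) mod (n + 1) = p - 2;
-- if n + 1 is composite then n + 1 divides 2 · n! (the factor 2 is needed only for n + 1 = 4),
-- so the residue is 0. Applied to p = n + 1 and to 2n + 3 = 2p + 1, this shows that g(n) = p
-- when p and 2p + 1 are both prime and g(n) = 2 otherwise; 2 is itself a Sophie Germain prime.
-- Wilson's theorem follows by pairing each of 2, …, p - 2 with its inverse modulo p, which
-- differs from it because x² ≡ 1 forces x ≡ ±1.
module Submission where

open import Defs

open import Data.Empty using (⊥-elim)
open import Data.List using (List; []; _∷_; _++_; length; applyDownFrom)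
open import Data.List.Membership.Propositional using (_∈_; _∉_)
open import Data.List.Membership.Propositional.Properties
  using (∈-∃++; ∈-applyDownFrom⁺; ∈-applyDownFrom⁻)
open import Data.List.Relation.Binary.Permutation.Propositional
  using (_↭_; ↭-refl; ↭-sym; ↭-trans; ↭-prep; ↭⇒↭ₛ)
open import Data.List.Relation.Binary.Permutation.Propositional.Properties
  using (∈-resp-↭; shift; ↭-length)
open import Data.List.Relation.Binary.Permutation.Setoid.Properties using (Unique-resp-↭)
open import Data.List.Relation.Unary.All using (All; []; _∷_)
open import Data.List.Relation.Unary.Any using (here; there)
open import Data.List.Relation.Unary.Unique.Propositional using (Unique; _∷_)
open import Data.List.Relation.Unary.Unique.Propositional.Properties
  using (Unique[x∷xs]⇒x∉xs; applyDownFrom⁺₁)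
open import Data.Nat
  using (ℕ; zero; suc; _+_; _*_; _∸_; _≤_; _<_; _>_; _!; _⊓_; z≤n; s≤s; z<s; NonZero; >-nonZero; nonTrivial⇒n>1)
open import Data.Nat.Coprimality using (coprime-Bézout; prime⇒coprime) renaming (sym to coprime-sym)
open import Data.Nat.DivMod
open import Data.Nat.Divisibility
  using (_∣_; divides; ∣⇒≤; ∣-trans; ∣-refl; m∣m*n; ∣n⇒∣m*n; n∣m⇒m%n≡0; *-pres-∣; *-monoʳ-∣; m≤n⇒m!∣n!;
         quotient; quotient>1; quotient-<; m∣n⇒n≡quotient*m)
open import Data.Nat.GCD using (module Bézout)
open import Data.Nat.ListAction using (product)
open import Data.Nat.ListAction.Properties using (product-↭)
open import Data.Nat.Primality
  using (Prime; Composite; composite; prime?; prime[2]; ¬prime[0]; ¬prime[1]; ¬prime⇒composite; euclidsLemma)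
open import Data.Nat.Properties
open import Data.Nat.Tactic.RingSolver using (solve-∀)
open import Data.Product using (_×_; _,_; ∃-syntax; proj₂; uncurry)
open import Data.Sum using (_⊎_; inj₁; inj₂)
open import Function using (_∘_)
open import Relation.Binary.Definitions using (Tri; tri<; tri≈; tri>)
open import Relation.Nullary using (¬_; yes; no; contradiction)
open import Relation.Nullary.Decidable using (from-yes)
open import Relation.Binary.PropositionalEquality
  using (_≡_; _≢_; refl; sym; trans; cong; cong₂; subst; subst₂; setoid; module ≡-Reasoning)

concatPairs : {A : Set} → List (A × A) → List A
concatPairs []             = []
concatPairs ((x , y) ∷ ps) = x ∷ y ∷ concatPairs ps

record PerfectMatching {A : Set} (R : A → A → Set) (xs : List A) : Set where
  field
    unique     : Unique xs
    partner    : ∀ {x} → x ∈ xs → ∃[ y ] y ∈ xs × x ≢ y × R x y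
    functional : ∀ {x y z} → y ∈ xs → z ∈ xs → R x y → R x z → y ≡ z

module _ {A : Set} {R : A → A → Set} where

  PerfectMatching-resp-↭ : ∀ {xs ys} → xs ↭ ys → PerfectMatching R xs → PerfectMatching R ys
  PerfectMatching-resp-↭ {xs} {ys} σ M = record
    { unique     = Unique-resp-↭ (setoid A) (↭⇒↭ₛ σ) unique
    ; partner    = partner′
    ; functional = λ y∈ys z∈ys → functional (back y∈ys) (back z∈ys)
    }
    where
    open PerfectMatching M
    back : ∀ {x} → x ∈ ys → x ∈ xs
    back = ∈-resp-↭ (↭-sym σ)
    partner′ : ∀ {x} → x ∈ ys → ∃[ y ] y ∈ ys × x ≢ y × R x y
    partner′ x∈ys with y , y∈xs , x≢y , Rxy ← partner (back x∈ys) = y , ∈-resp-↭ σ y∈xs , x≢y , Rxy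

  PerfectMatching-unpair : (∀ {x y} → R x y → R y x) → ∀ {x y xs} → R x y →
                           PerfectMatching R (x ∷ y ∷ xs) → PerfectMatching R xs
  PerfectMatching-unpair R-sym {x} {y} {xs} Rxy M = record
    { unique     = unique′
    ; partner    = partner′
    ; functional = λ y∈xs z∈xs → functional (there (there y∈xs)) (there (there z∈xs))
    }
    where
    open PerfectMatching M
    unique′ : Unique xs
    unique′ with _ ∷ _ ∷ u ← unique = u
    x∉xs : x ∉ xs
    x∉xs z∈xs = Unique[x∷xs]⇒x∉xs unique (there z∈xs)
    y∉xs : y ∉ xs
    y∉xs with _ ∷ u ← unique = Unique[x∷xs]⇒x∉xs u
    partner′ : ∀ {z} → z ∈ xs → ∃[ w ] w ∈ xs × z ≢ w × R z w
    partner′ z∈xs with partner (there (there z∈xs))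
    ... | w , here refl , _ , Rzx =
      ⊥-elim (y∉xs (subst (_∈ xs) (functional (there (there z∈xs)) (there (here refl)) (R-sym Rzx) Rxy) z∈xs))
    ... | w , there (here refl) , _ , Rzy =
      ⊥-elim (x∉xs (subst (_∈ xs) (functional (there (there z∈xs)) (here refl) (R-sym Rzy) (R-sym Rxy)) z∈xs))
    ... | w , there (there w∈xs) , z≢w , Rzw = w , w∈xs , z≢w , Rzw

  PerfectMatching-split : ∀ {x xs} → PerfectMatching R (x ∷ xs) →
                          ∃[ y ] ∃[ ys ] R x y × x ∷ xs ↭ x ∷ y ∷ ys × length ys < length xs
  PerfectMatching-split {x} M with PerfectMatching.partner M (here refl)
  ... | _ , here refl , x≢x , _ = ⊥-elim (x≢x refl)
  ... | y , there y∈xs , _ , Rxy with ys , zs , refl ← ∈-∃++ y∈xs =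
    y , ys ++ zs , Rxy , ↭-prep x (shift y ys zs) , ≤-reflexive (sym (↭-length (shift y ys zs)))

  perfectMatching⇒pairs : (∀ {x y} → R x y → R y x) → ∀ {xs} → PerfectMatching R xs →
                          ∃[ ps ] All (uncurry R) ps × xs ↭ concatPairs ps
  perfectMatching⇒pairs R-sym {xs} = go (length xs) ≤-refl
    where
    go : ∀ n {xs} → length xs ≤ n → PerfectMatching R xs →
         ∃[ ps ] All (uncurry R) ps × xs ↭ concatPairs ps
    go _ {[]} _ _ = [] , [] , ↭-refl
    go (suc n) {x ∷ _} (s≤s len) M
      with y , ys , Rxy , σ , shorter ← PerfectMatching-split M
      with ps , Rps , τ ← go n (<⇒≤ (<-≤-trans shorter len))
                            (PerfectMatching-unpair R-sym Rxy (PerfectMatching-resp-↭ σ M))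
      = (x , y) ∷ ps , Rxy ∷ Rps , ↭-trans σ (↭-prep x (↭-prep y τ))

InverseMod : (d : ℕ) .{{_ : NonZero d}} → ℕ → ℕ → Set
InverseMod d x y = (x * y) % d ≡ 1 % d

module _ {d : ℕ} .{{_ : NonZero d}} where

  %≡%⇒≡ : ∀ {m n} → m < d → n < d → m % d ≡ n % d → m ≡ n
  %≡%⇒≡ m<d n<d eq = trans (sym (m<n⇒m%n≡m m<d)) (trans eq (m<n⇒m%n≡m n<d))

  %≡%⇒∣∸ : ∀ {m n} → m ≤ n → m % d ≡ n % d → d ∣ n ∸ m
  %≡%⇒∣∸ {m} {n} m≤n eq = divides (n / d ∸ m / d) (begin
      n ∸ m
    ≡⟨ cong₂ _∸_ (m≡m%n+[m/n]*n n d) (m≡m%n+[m/n]*n m d) ⟩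
      (n % d + n / d * d) ∸ (m % d + m / d * d)
    ≡⟨ cong (λ r → (n % d + n / d * d) ∸ (r + m / d * d)) eq ⟩
      (n % d + n / d * d) ∸ (n % d + m / d * d)
    ≡⟨ [m+n]∸[m+o]≡n∸o (n % d) _ _ ⟩
      n / d * d ∸ m / d * d
    ≡⟨ *-distribʳ-∸ d (n / d) (m / d) ⟨
      (n / d ∸ m / d) * d
    ∎)
    where open ≡-Reasoning

  *-cong-% : ∀ {a b c e} → a % d ≡ b % d → c % d ≡ e % d → (a * c) % d ≡ (b * e) % d
  *-cong-% {a} {b} {c} {e} a≡b c≡e = begin
    (a * c) % d              ≡⟨ %-distribˡ-* a c d ⟩
    ((a % d) * (c % d)) % d  ≡⟨ cong₂ (λ r s → (r * s) % d) a≡b c≡e ⟩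
    ((b % d) * (e % d)) % d  ≡⟨ %-distribˡ-* b e d ⟨
    (b * e) % d              ∎
    where open ≡-Reasoning

  InverseMod-sym : ∀ {x y} → InverseMod d x y → InverseMod d y x
  InverseMod-sym {x} {y} = trans (cong (_% d) (*-comm y x))

  InverseMod-reduce : ∀ {x y} → InverseMod d x y → ∃[ z ] z < d × InverseMod d x z
  InverseMod-reduce {x} {y} xy≡1 =
    y % d , m%n<n y d , trans (*-cong-% {a = x} refl (m%n%n≡m%n y d)) xy≡1

  InverseMod-unique : ∀ {x y z} → y < d → z < d → InverseMod d x y → InverseMod d x z → y ≡ z
  InverseMod-unique {x} {y} {z} y<d z<d xy≡1 xz≡1 = %≡%⇒≡ y<d z<d (begin
    y % d              ≡⟨ cong (_% d) (*-identityʳ y) ⟨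
    (y * 1) % d        ≡⟨ *-cong-% {a = y} refl (sym xz≡1) ⟩
    (y * (x * z)) % d  ≡⟨ cong (_% d) (*-assoc y x z) ⟨
    (y * x * z) % d    ≡⟨ *-cong-% (InverseMod-sym {x} xy≡1) (refl {x = z % d}) ⟩
    (1 * z) % d        ≡⟨ cong (_% d) (*-identityˡ z) ⟩
    z % d              ∎)
    where open ≡-Reasoning

  product-concatPairs : ∀ ps → All (uncurry (InverseMod d)) ps → product (concatPairs ps) % d ≡ 1 % d
  product-concatPairs []             []            = refl
  product-concatPairs ((x , y) ∷ ps) (xy≡1 ∷ ps≡1) = begin
    (x * (y * product (concatPairs ps))) % d  ≡⟨ cong (_% d) (*-assoc x y _) ⟨
    (x * y * product (concatPairs ps)) % d    ≡⟨ *-cong-% xy≡1 (product-concatPairs ps ps≡1) ⟩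
    (1 * 1) % d                               ∎
    where open ≡-Reasoning

  product-perfectMatching : ∀ {xs} → PerfectMatching (InverseMod d) xs → product xs % d ≡ 1 % d
  product-perfectMatching M
    with ps , ps≡1 , σ ← perfectMatching⇒pairs (λ {x} {y} → InverseMod-sym {x = x} {y = y}) M =
    trans (cong (_% d) (product-↭ σ)) (product-concatPairs ps ps≡1)

InverseMod-pred-self : ∀ n → InverseMod (suc n) n n
InverseMod-pred-self n = begin
  (n * n) % suc n              ≡⟨ [m+kn]%n≡m%n (n * n) 2 (suc n) ⟨
  (n * n + 2 * suc n) % suc n  ≡⟨ cong (_% suc n) (identity n) ⟩
  (1 + suc n * suc n) % suc n  ≡⟨ [m+kn]%n≡m%n 1 (suc n) (suc n) ⟩
  1 % suc n                    ∎
  where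
  open ≡-Reasoning
  identity : ∀ n → n * n + 2 * suc n ≡ 1 + suc n * suc n
  identity = solve-∀

module _ {n : ℕ} (p-prime : Prime (suc n)) where

  InverseMod-exists : ∀ {x} → 0 < x → x < suc n → ∃[ y ] y < suc n × InverseMod (suc n) x y
  InverseMod-exists {x} 0<x x<p
    with coprime-Bézout (coprime-sym (prime⇒coprime p-prime {{>-nonZero 0<x}} x<p))
  ... | Bézout.+- a b eq = InverseMod-reduce {x = x} (begin
    (x * a) % suc n          ≡⟨ cong (_% suc n) (trans (*-comm x a) (sym eq)) ⟩
    (1 + b * suc n) % suc n  ≡⟨ [m+kn]%n≡m%n 1 b (suc n) ⟩
    1 % suc n                ∎)
    where open ≡-Reasoning
  -- Here a · x ≡ -1, so a · (p - 1) is the inverse.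
  ... | Bézout.-+ a b eq = InverseMod-reduce {x = x} (begin
    (x * (a * n)) % suc n          ≡⟨ [m+n]%n≡m%n (x * (a * n)) (suc n) ⟨
    (x * (a * n) + suc n) % suc n  ≡⟨ cong (_% suc n) (identity x a n) ⟩
    ((1 + a * x) * n + 1) % suc n  ≡⟨ cong (λ t → (t * n + 1) % suc n) eq ⟩
    (b * suc n * n + 1) % suc n    ≡⟨ cong (_% suc n) (identity′ b n) ⟩
    (1 + b * n * suc n) % suc n    ≡⟨ [m+kn]%n≡m%n 1 (b * n) (suc n) ⟩
    1 % suc n                      ∎)
    where
    open ≡-Reasoning
    identity : ∀ x a n → x * (a * n) + suc n ≡ (1 + a * x) * n + 1
    identity = solve-∀
    identity′ : ∀ b n → b * suc n * n + 1 ≡ 1 + b * n * suc n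
    identity′ = solve-∀

  InverseMod-self⇒1∨pred : ∀ {x} → 0 < x → x < suc n → InverseMod (suc n) x x → x ≡ 1 ⊎ x ≡ n
  InverseMod-self⇒1∨pred {suc y} _ x<p xx≡1 with euclidsLemma y (2 + y) p-prime p∣y[2+y]
    where
    identity : ∀ y → suc y * suc y ≡ 1 + y * (2 + y)
    identity = solve-∀
    p∣y[2+y] : suc n ∣ y * (2 + y)
    p∣y[2+y] = subst (suc n ∣_) (cong (_∸ 1) (identity y)) (%≡%⇒∣∸ (s≤s z≤n) (sym xx≡1))
  InverseMod-self⇒1∨pred {suc zero}    _ _   _ | inj₁ _   = inj₁ refl
  InverseMod-self⇒1∨pred {suc (suc _)} _ x<p _ | inj₁ p∣y =
    contradiction (∣⇒≤ p∣y) (<⇒≱ (<-trans (n<1+n _) x<p))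
  InverseMod-self⇒1∨pred _ x<p _ | inj₂ p∣2+y = inj₂ (suc-injective (≤-antisym x<p (∣⇒≤ p∣2+y)))

  InverseMod-between : ∀ {x} → 1 < x → x < n →
                       ∃[ y ] 1 < y × y < n × x ≢ y × InverseMod (suc n) x y
  InverseMod-between {x} 1<x x<n
    with y , y<p , xy≡1 ← InverseMod-exists (<-trans z<s 1<x) (m<n⇒m<1+n x<n) =
    y , ≤∧≢⇒< (≤∧≢⇒< z≤n (y≢0 ∘ sym)) (y≢1 ∘ sym) , ≤∧≢⇒< (≤-pred y<p) y≢n , x≢y , xy≡1
    where
    1<p : 1 < suc n
    1<p = m<n⇒m<1+n (<-trans 1<x x<n)
    y≢0 : y ≢ 0
    y≢0 refl = 0≢1+n (%≡%⇒≡ z<s 1<p (trans (cong (_% suc n) (sym (*-zeroʳ x))) xy≡1))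
    y≢1 : y ≢ 1
    y≢1 refl = <⇒≢ 1<x (sym (%≡%⇒≡ (m<n⇒m<1+n x<n) 1<p
                                    (trans (cong (_% suc n) (sym (*-identityʳ x))) xy≡1)))
    y≢n : y ≢ n
    y≢n refl = <⇒≢ x<n (InverseMod-unique {x = n} (m<n⇒m<1+n x<n) (n<1+n n)
                                          (InverseMod-sym {x = x} xy≡1) (InverseMod-pred-self n))
    x≢y : x ≢ y
    x≢y refl with InverseMod-self⇒1∨pred (<-trans z<s 1<x) y<p xy≡1
    ... | inj₁ x≡1 = <⇒≢ 1<x (sym x≡1)
    ... | inj₂ x≡n = <⇒≢ x<n x≡n

suc-!≡product : ∀ n → suc n ! ≡ product (applyDownFrom (2 +_) n)
suc-!≡product zero    = refl
suc-!≡product (suc n) = cong (suc (suc n) *_) (suc-!≡product n)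

wilsonsTheorem : ∀ {n} → Prime (suc n) → n ! % suc n ≡ n
wilsonsTheorem {zero}        p-prime = ⊥-elim (¬prime[1] p-prime)
wilsonsTheorem {suc zero}    _       = refl
wilsonsTheorem {suc (suc j)} p-prime = begin
  (n * suc j !) % suc n        ≡⟨ cong (λ t → (n * t) % suc n) (suc-!≡product j) ⟩
  (n * product units) % suc n  ≡⟨ *-cong-% {a = n} {n} {product units} {1} refl
                                           (product-perfectMatching matching) ⟩
  (n * 1) % suc n              ≡⟨ cong (_% suc n) (*-identityʳ n) ⟩
  n % suc n                    ≡⟨ m<n⇒m%n≡m (n<1+n n) ⟩
  n                            ∎
  where
  open ≡-Reasoning
  n : ℕ
  n = suc (suc j)
  units : List ℕ
  units = applyDownFrom (2 +_) j
  ∈⇒between : ∀ {x} → x ∈ units → 1 < x × x < n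
  ∈⇒between x∈ with i , i<j , refl ← ∈-applyDownFrom⁻ (2 +_) x∈ = s≤s (s≤s z≤n) , s≤s (s≤s i<j)
  between⇒∈ : ∀ {x} → 1 < x → x < n → x ∈ units
  between⇒∈ {suc zero}    (s≤s ()) _
  between⇒∈ {suc (suc _)} _        (s≤s (s≤s i<j)) = ∈-applyDownFrom⁺ (2 +_) i<j
  ∈⇒<p : ∀ {x} → x ∈ units → x < suc n
  ∈⇒<p = m<n⇒m<1+n ∘ proj₂ ∘ ∈⇒between
  matching : PerfectMatching (InverseMod (suc n)) units
  matching = record
    { unique     = applyDownFrom⁺₁ (2 +_) j (λ j<i _ eq → <⇒≢ j<i (sym (+-cancelˡ-≡ 2 _ _ eq)))
    ; partner    = λ x∈ → let 1<x , x<n = ∈⇒between x∈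
                              y , 1<y , y<n , x≢y , xy≡1 = InverseMod-between p-prime 1<x x<n
                          in y , between⇒∈ 1<y y<n , x≢y , xy≡1
    ; functional = λ {x} y∈ z∈ → InverseMod-unique {x = x} (∈⇒<p y∈) (∈⇒<p z∈)
    }

m∣n! : ∀ {m n} → 0 < m → m ≤ n → m ∣ n !
m∣n! {suc m} _ m<n = ∣-trans (m∣m*n (m !)) (m≤n⇒m!∣n! m<n)

m*n∣o! : ∀ {m n o} → 0 < m → m < n → n ≤ o → m * n ∣ o !
m*n∣o! {m} {suc n} 0<m (s≤s m≤n) n<o =
  ∣-trans (subst (m * suc n ∣_) (*-comm (n !) (suc n)) (*-pres-∣ (m∣n! 0<m m≤n) (∣-refl {suc n})))
          (m≤n⇒m!∣n! n<o)

composite∣pred! : ∀ {n} → suc n ≢ 4 → Composite (suc n) → suc n ∣ n !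
-- For N = e · d with d ≠ e both factors occur in n!; for N = d² with d ≥ 3 use d and 2d instead.
composite∣pred! {n} N≢4 (composite {d} d<N d∣N) = byComparison (<-cmp d e)
  where
  e : ℕ
  e = quotient d∣N
  N≡e*d : suc n ≡ e * d
  N≡e*d = m∣n⇒n≡quotient*m d∣N
  1<d : 1 < d
  1<d = nonTrivial⇒n>1 d
  0<d : 0 < d
  0<d = <-trans z<s 1<d
  byComparison : Tri (d < e) (d ≡ e) (d > e) → suc n ∣ n !
  byComparison (tri< d<e _ _) =
    subst (_∣ n !) (trans (*-comm d e) (sym N≡e*d)) (m*n∣o! 0<d d<e (≤-pred (quotient-< d∣N)))
  byComparison (tri> _ _ e<d) =
    subst (_∣ n !) (sym N≡e*d) (m*n∣o! (<-trans z<s (quotient>1 d∣N d<N)) e<d (≤-pred d<N))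
  byComparison (tri≈ _ d≡e _) =
    ∣-trans (subst (_∣ d * (d * 2)) (sym N≡d*d) (*-monoʳ-∣ d (m∣m*n 2)))
            (m*n∣o! 0<d (m<m*n d 2 {{>-nonZero 0<d}} (s≤s (s≤s z≤n))) (≤-pred d*2<N))
    where
    N≡d*d : suc n ≡ d * d
    N≡d*d = trans N≡e*d (cong (_* d) (sym d≡e))
    2<d : 2 < d
    2<d = ≤∧≢⇒< 1<d λ d≡2 → N≢4 (trans N≡d*d (cong₂ _*_ (sym d≡2) (sym d≡2)))
    d*2<N : d * 2 < suc n
    d*2<N = subst (d * 2 <_) (sym N≡d*d) (*-monoʳ-< d {{>-nonZero 0<d}} 2<d)

twiceFactorialMod : ℕ → ℕ
twiceFactorialMod n = (2 * n !) % suc n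

twiceFactorialMod-¬prime : ∀ {n} → ¬ Prime (suc n) → twiceFactorialMod n ≡ 0
twiceFactorialMod-¬prime {zero}  _ = refl
twiceFactorialMod-¬prime {suc n} ¬prime with suc (suc n) ≟ 4
... | yes refl = refl  -- 4 ∤ 3!, but 4 ∣ 2 · 3!
... | no N≢4   = n∣m⇒m%n≡0 _ _ (∣n⇒∣m*n 2 (composite∣pred! N≢4 (¬prime⇒composite ¬prime)))

twiceFactorialMod-prime : ∀ {n} → Prime (suc n) → suc (twiceFactorialMod n) ≡ n
twiceFactorialMod-prime {zero}  p-prime = ⊥-elim (¬prime[1] p-prime)
twiceFactorialMod-prime {suc k} p-prime = cong suc (begin
  (2 * suc k !) % (2 + k)    ≡⟨ *-cong-% {a = 2} {2} {suc k !} {suc k} refl wilson′ ⟩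
  (2 * suc k) % (2 + k)      ≡⟨ cong (_% (2 + k)) (identity k) ⟩
  (k + (2 + k)) % (2 + k)    ≡⟨ [m+n]%n≡m%n k (2 + k) ⟩
  k % (2 + k)                ≡⟨ m<n⇒m%n≡m (m<n⇒m<1+n (n<1+n k)) ⟩
  k                          ∎)
  where
  open ≡-Reasoning
  wilson′ : suc k ! % (2 + k) ≡ suc k % (2 + k)
  wilson′ = trans (wilsonsTheorem p-prime) (sym (m<n⇒m%n≡m (n<1+n (suc k))))
  identity : ∀ k → 2 * suc k ≡ k + (2 + k)
  identity = solve-∀

2[1+n]+1≡1+[2n+2] : ∀ n → 2 * suc n + 1 ≡ suc (2 * n + 2)
2[1+n]+1≡1+[2n+2] = solve-∀

sophieGermain⇒g≡1+n : ∀ {n} → SophieGermain (suc n) → g n ≡ suc n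
sophieGermain⇒g≡1+n {n} (p-prime , q-prime) = begin
  2 + (twiceFactorialMod n ⊓ twiceFactorialMod (2 * n + 2))  ≡⟨ cong (2 +_) (m≤n⇒m⊓n≡m residues-≤) ⟩
  2 + twiceFactorialMod n                                    ≡⟨ cong suc (twiceFactorialMod-prime p-prime) ⟩
  suc n                                                      ∎
  where
  open ≡-Reasoning
  residues-≤ : twiceFactorialMod n ≤ twiceFactorialMod (2 * n + 2)
  residues-≤ = ≤-pred (subst₂ _≤_ (sym (twiceFactorialMod-prime p-prime))
                                  (sym (twiceFactorialMod-prime (subst Prime (2[1+n]+1≡1+[2n+2] n) q-prime)))
                                  (≤-trans (m≤m+n n (n + 0)) (m≤m+n (2 * n) 2)))

¬prime⊎¬prime⇒g≡2 : ∀ {n} → ¬ Prime (suc n) ⊎ ¬ Prime (2 * suc n + 1) → g n ≡ 2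
¬prime⊎¬prime⇒g≡2 {n} (inj₁ ¬p-prime) = cong (λ r → 2 + (r ⊓ twiceFactorialMod (2 * n + 2))) (twiceFactorialMod-¬prime ¬p-prime)
¬prime⊎¬prime⇒g≡2 {n} (inj₂ ¬q-prime) = begin
  2 + (twiceFactorialMod n ⊓ twiceFactorialMod (2 * n + 2))  ≡⟨ cong (λ r → 2 + (twiceFactorialMod n ⊓ r)) residue≡0 ⟩
  2 + (twiceFactorialMod n ⊓ 0)                              ≡⟨ cong (2 +_) (⊓-zeroʳ (twiceFactorialMod n)) ⟩
  2                                                          ∎
  where
  open ≡-Reasoning
  residue≡0 : twiceFactorialMod (2 * n + 2) ≡ 0
  residue≡0 = twiceFactorialMod-¬prime (¬q-prime ∘ subst Prime (sym (2[1+n]+1≡1+[2n+2] n)))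

sophieGermain[2] : SophieGermain 2
sophieGermain[2] = prime[2] , from-yes (prime? 5)

mainTheorem3 : ((n : ℕ) → SophieGermain (g n))
               × ((p : ℕ) → SophieGermain p → ∃[ n ] g n ≡ p)
mainTheorem3 = sophieGermain-g , g-surjective
  where
  sophieGermain-g : ∀ n → SophieGermain (g n)
  sophieGermain-g n with prime? (suc n) | prime? (2 * suc n + 1)
  ... | yes p-prime | yes q-prime = subst SophieGermain (sym (sophieGermain⇒g≡1+n sg)) sg
    where sg = p-prime , q-prime
  ... | no ¬p-prime | _           = subst SophieGermain (sym (¬prime⊎¬prime⇒g≡2 (inj₁ ¬p-prime))) sophieGermain[2]
  ... | yes _       | no ¬q-prime = subst SophieGermain (sym (¬prime⊎¬prime⇒g≡2 (inj₂ ¬q-prime))) sophieGermain[2]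
  g-surjective : ∀ p → SophieGermain p → ∃[ n ] g n ≡ p
  g-surjective zero    (0-prime , _) = ⊥-elim (¬prime[0] 0-prime)
  g-surjective (suc n) sg            = n , sophieGermain⇒g≡1+n sg
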